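{- Let ${\cal ODCT}_n$ be the set of full transformations $\alpha$ of $X_n=\{1,\dots,n\}$ that are order-preserving, order-decreasing and contractions. Then the number of $\alpha\in{\cal ODCT}_n$ with $f(\alpha)=n$ is $1$, and for $1\le m<n$ the number of $\alpha\in{\cal ODCT}_n$ with $f(\alpha)=m$ is $2^{n-m-1}$.
   Context: Full transformations are maps $\alpha:X_n\to X_n$, written $x\mapsto x\alpha$. Order-preserving: $x\le y\Rightarrow x\alpha\le y\alpha$. Order-decreasing: $x\alpha\le x$ for all $x$. Contraction: $|x\alpha-y\alpha|\le|x-y|$ for all $x,y$. $f(\alpha)=|\{x:x\alpha=x\}|$. -}

module Defs where

import Data.Nat
open import Data.Nat using (ℕ; _≤_; ∣_-_∣)
open import Data.Fin using (Fin; toℕ)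
open import Data.Vec using (Vec; lookup)
open import Data.Product using (Σ; _×_)
open import Data.List using (List; length; filter)
open import Data.Fin.Properties using (_≟_)
open import Data.Fin.Subset using (Subset; ∣_∣)
open import Data.Vec using (tabulate)
open import Data.Bool using (true; false)
open import Relation.Nullary using (does)
open import Relation.Binary.PropositionalEquality using (_≡_)

-- A full transformation of X_n, represented by its table of images:
-- the element x ∈ Fin n (standing for x+1 ∈ {1,…,n}) is sent to  lookup α x.
Transformation : ℕ → Set
Transformation n = Vec (Fin n) n

_·_ : ∀ {n} → Fin n → Transformation n → Fin n
x · α = lookup α x

OrderPreserving : ∀ {n} → Transformation n → Set
OrderPreserving {n} α = (x y : Fin n) → toℕ x ≤ toℕ y → toℕ (x · α) ≤ toℕ (y · α)

OrderDecreasing : ∀ {n} → Transformation n → Set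
OrderDecreasing {n} α = (x : Fin n) → toℕ (x · α) ≤ toℕ x

Contraction : ∀ {n} → Transformation n → Set
Contraction {n} α = (x y : Fin n) → ∣ toℕ (x · α) - toℕ (y · α) ∣ ≤ ∣ toℕ x - toℕ y ∣

IsODCT : ∀ {n} → Transformation n → Set
IsODCT α = OrderPreserving α × OrderDecreasing α × Contraction α

Fix : ∀ {n} → Transformation n → Subset n
Fix α = tabulate (λ x → does (x · α ≟ x))

f : ∀ {n} → Transformation n → ℕ
f α = ∣ Fix α ∣

open import Data.Nat.Properties using (_≤?_)
open import Data.Fin.Properties using (all?)
open import Relation.Nullary.Decidable using (Dec; yes; no; _×-dec_; _→-dec_)
open import Data.List using (_∷_; []; concatMap; map; allFin)
open import Data.Vec using ([]; _∷_)

isODCT? : ∀ {n} (α : Transformation n) → Dec (IsODCT α)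
isODCT? α =
  all? (λ x → all? (λ y → (toℕ x ≤? toℕ y) →-dec (toℕ (x · α) ≤? toℕ (y · α))))
  ×-dec all? (λ x → toℕ (x · α) ≤? toℕ x)
  ×-dec all? (λ x → all? (λ y → ∣ toℕ (x · α) - toℕ (y · α) ∣ ≤? ∣ toℕ x - toℕ y ∣))

allVecs : (n k : ℕ) → List (Vec (Fin n) k)
allVecs n ℕ.zero = [] ∷ []
allVecs n (ℕ.suc k) = concatMap (λ i → map (i ∷_) (allVecs n k)) (allFin n)

allTransformations : (n : ℕ) → List (Transformation n)
allTransformations n = allVecs n n

countODCT : (n m : ℕ) → ℕ
countODCT n m = length (filter (λ α → isODCT? α ×-dec (f α Data.Nat.≟ m)) (allTransformations n))

module Submission where

-- Write images as numbers 0,…,n-1.  A table α = i ∷ v lies in ODCT_n iff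
-- i = 0 and every entry equals its predecessor or exceeds it by one: such
-- a "staircase" is automatically order-preserving, contracting, and (since
-- it starts at 0) order-decreasing; conversely order-preservation and
-- contraction applied to neighbouring positions force unit steps.  On a
-- staircase the fixed points form an initial segment: once an entry drops
-- below the diagonal it can never climb back.  Hence an α ∈ ODCT_n with
-- f(α) = m+1 is: m further steps up the diagonal, then (if m < n-1) one
-- flat step, then an arbitrary staircase of n-m-2 steps, of which there
-- are 2^(n-m-2).

open import Defs
open import Data.Nat using (ℕ; zero; suc; _+_; _≤_; _<_; _∸_; _^_; z≤n; s≤s; ∣_-_∣)
import Data.Nat as ℕ
open import Data.Nat.Properties
  using (≤-refl; ≤-trans; ≤-total; ≤-<-trans; ≤-reflexive; n≤1+n; m≤m+n; +-monoˡ-≤; +-monoʳ-≤; +-suc;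
         +-identityʳ; suc-injective; 1+n≢n; 1+n≢0; 0≢1+n; <⇒≢; n≤0⇒n≡0; ∣-∣-comm; m≤n⇒∣m-n∣≡n∸m; m≤n+o⇒m∸n≤o)
open import Data.Nat.ListAction using (sum)
open import Data.Fin using (Fin; zero; suc; toℕ)
open import Data.Fin.Properties using (_≟_; toℕ-injective)
open import Data.Fin.Subset using (Subset; ∣_∣)
open import Data.Vec using (Vec; []; _∷_; lookup; tabulate)
open import Data.List using (List; _++_; map; concatMap; filter; length; allFin)
import Data.List as List
open import Data.List.Properties using (filter-≐; filter-++; filter-none; length-++; map-cong; map-tabulate)
open import Data.List.Relation.Unary.All using (universal)
open import Data.Product using (_×_; _,_; proj₁; proj₂)
open import Data.Sum using (_⊎_; inj₁; inj₂)
import Data.Sum as Sum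
open import Data.Unit using (⊤; tt)
open import Data.Bool using (true; false)
open import Data.Empty using (⊥-elim)
open import Function using (_∘_; id)
open import Relation.Nullary using (¬_; Dec; yes; no; does)
open import Relation.Nullary.Decidable using (_×-dec_; _⊎-dec_; dec-true; dec-false)
open import Relation.Unary using (Pred; Decidable; _≐_)
open import Relation.Binary.PropositionalEquality
  using (_≡_; _≢_; refl; sym; trans; cong; cong₂; subst; subst₂; module ≡-Reasoning)

count : ∀ {a p} {A : Set a} {P : Pred A p} → Decidable P → List A → ℕ
count P? xs = length (filter P? xs)

module _ {a p} {A : Set a} {P : Pred A p} (P? : Decidable P) where

  count-≐ : ∀ {q} {Q : Pred A q} (Q? : Decidable Q) → P ≐ Q → ∀ xs → count P? xs ≡ count Q? xs
  count-≐ Q? P≐Q xs = cong length (filter-≐ P? Q? P≐Q xs)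

  count-none : (∀ x → ¬ P x) → ∀ xs → count P? xs ≡ 0
  count-none ¬P xs = cong length (filter-none P? (universal ¬P xs))

  count-++ : ∀ xs ys → count P? (xs ++ ys) ≡ count P? xs + count P? ys
  count-++ xs ys = trans (cong length (filter-++ P? xs ys)) (length-++ (filter P? xs))

  count-map : ∀ {b} {B : Set b} (g : B → A) xs → count P? (map g xs) ≡ count (P? ∘ g) xs
  count-map g List.[] = refl
  count-map g (x List.∷ xs) with does (P? (g x))
  ... | true  = cong suc (count-map g xs)
  ... | false = count-map g xs

  count-concatMap : ∀ {b} {B : Set b} (g : B → List A) xs →
                    count P? (concatMap g xs) ≡ sum (map (count P? ∘ g) xs)
  count-concatMap g List.[]         = refl
  count-concatMap g (x List.∷ xs) =
    trans (count-++ (g x) (concatMap g xs)) (cong (count P? (g x) +_) (count-concatMap g xs))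

sum-tabulate-zero : ∀ {N} (g : Fin N → ℕ) → (∀ j → g j ≡ 0) → sum (List.tabulate g) ≡ 0
sum-tabulate-zero {zero}  g vanish = refl
sum-tabulate-zero {suc N} g vanish = cong₂ _+_ (vanish zero) (sum-tabulate-zero (g ∘ suc) (vanish ∘ suc))

sum-tabulate-point : ∀ {N a c} (g : Fin N → ℕ) → a < N →
  (∀ j → toℕ j ≡ a → g j ≡ c) → (∀ j → toℕ j ≢ a → g j ≡ 0) → sum (List.tabulate g) ≡ c
sum-tabulate-point {suc N} {zero} {c} g _ at off =
  trans (cong₂ _+_ (at zero refl) (sum-tabulate-zero (g ∘ suc) (λ j → off (suc j) (λ ()))))
        (+-identityʳ c)
sum-tabulate-point {suc N} {suc a} g (s≤s a<N) at off =
  cong₂ _+_ (off zero (λ ()))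
            (sum-tabulate-point (g ∘ suc) a<N (λ j e → at (suc j) (cong suc e))
                                              (λ j ne → off (suc j) (ne ∘ suc-injective)))

sum-tabulate-pair : ∀ {N a c₀ c₁} (g : Fin N → ℕ) → suc a < N →
  (∀ j → toℕ j ≡ a → g j ≡ c₀) → (∀ j → toℕ j ≡ suc a → g j ≡ c₁) →
  (∀ j → toℕ j ≢ a → toℕ j ≢ suc a → g j ≡ 0) → sum (List.tabulate g) ≡ c₀ + c₁
sum-tabulate-pair {suc N} {zero} g (s≤s a<N) at₀ at₁ off =
  cong₂ _+_ (at₀ zero refl)
            (sum-tabulate-point (g ∘ suc) a<N (λ j e → at₁ (suc j) (cong suc e))
                                              (λ j ne → off (suc j) (λ ()) (ne ∘ suc-injective)))
sum-tabulate-pair {suc N} {suc a} g (s≤s a<N) at₀ at₁ off =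
  cong₂ _+_ (off zero (λ ()) (λ ()))
            (sum-tabulate-pair (g ∘ suc) a<N (λ j e → at₀ (suc j) (cong suc e))
                                             (λ j e → at₁ (suc j) (cong suc e))
                                             (λ j ne₀ ne₁ → off (suc j) (ne₀ ∘ suc-injective) (ne₁ ∘ suc-injective)))

module _ {N k p} {P : Pred (Vec (Fin N) (suc k)) p} (P? : Decidable P) where

  count-by-head : count P? (allVecs N (suc k))
                ≡ sum (List.tabulate (λ j → count (λ v → P? (j ∷ v)) (allVecs N k)))
  count-by-head = begin
    count P? (concatMap (λ j → map (j ∷_) (allVecs N k)) (allFin N))
      ≡⟨ count-concatMap P? (λ j → map (j ∷_) (allVecs N k)) (allFin N) ⟩
    sum (map (λ j → count P? (map (j ∷_) (allVecs N k))) (allFin N))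
      ≡⟨ cong sum (map-cong (λ j → count-map P? (j ∷_) (allVecs N k)) (allFin N)) ⟩
    sum (map (λ j → count (λ v → P? (j ∷ v)) (allVecs N k)) (allFin N))
      ≡⟨ cong sum (map-tabulate id (λ j → count (λ v → P? (j ∷ v)) (allVecs N k))) ⟩
    sum (List.tabulate (λ j → count (λ v → P? (j ∷ v)) (allVecs N k)))
      ∎
    where open ≡-Reasoning

  count-head-point : ∀ {a q} {Q : Pred (Vec (Fin N) k) q} (Q? : Decidable Q) → a < N →
    (∀ j → (λ v → P (j ∷ v)) ≐ (λ v → toℕ j ≡ a × Q v)) →
    count P? (allVecs N (suc k)) ≡ count Q? (allVecs N k)
  count-head-point {a} Q? a<N split = trans count-by-head (sum-tabulate-point _ a<N at off)
    where
    at : ∀ j → toℕ j ≡ a → count (λ v → P? (j ∷ v)) (allVecs N k) ≡ count Q? (allVecs N k)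
    at j e = count-≐ _ Q? ((λ Pjv → proj₂ (proj₁ (split j) Pjv)) , (λ Qv → proj₂ (split j) (e , Qv))) (allVecs N k)
    off : ∀ j → toℕ j ≢ a → count (λ v → P? (j ∷ v)) (allVecs N k) ≡ 0
    off j ne = count-none _ (λ v Pjv → ne (proj₁ (proj₁ (split j) Pjv))) (allVecs N k)

  count-head-pair : ∀ {a q₀ q₁} {Q₀ : Pred (Vec (Fin N) k) q₀} {Q₁ : Pred (Vec (Fin N) k) q₁}
    (Q₀? : Decidable Q₀) (Q₁? : Decidable Q₁) → suc a < N →
    (∀ j → (λ v → P (j ∷ v)) ≐ (λ v → (toℕ j ≡ a × Q₀ v) ⊎ (toℕ j ≡ suc a × Q₁ v))) →
    count P? (allVecs N (suc k)) ≡ count Q₀? (allVecs N k) + count Q₁? (allVecs N k)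
  count-head-pair {a} {Q₀ = Q₀} {Q₁ = Q₁} Q₀? Q₁? a+1<N split = trans count-by-head (sum-tabulate-pair _ a+1<N at₀ at₁ off)
    where
    at₀ : ∀ j → toℕ j ≡ a → count (λ v → P? (j ∷ v)) (allVecs N k) ≡ count Q₀? (allVecs N k)
    at₀ j e = count-≐ _ Q₀? (to , (λ Qv → proj₂ (split j) (inj₁ (e , Qv)))) (allVecs N k)
      where
      to : ∀ {v} → P (j ∷ v) → Q₀ v
      to Pjv with proj₁ (split j) Pjv
      ... | inj₁ (_ , Qv)  = Qv
      ... | inj₂ (e′ , _) = ⊥-elim (1+n≢n (trans (sym e′) e))
    at₁ : ∀ j → toℕ j ≡ suc a → count (λ v → P? (j ∷ v)) (allVecs N k) ≡ count Q₁? (allVecs N k)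
    at₁ j e = count-≐ _ Q₁? (to , (λ Qv → proj₂ (split j) (inj₂ (e , Qv)))) (allVecs N k)
      where
      to : ∀ {v} → P (j ∷ v) → Q₁ v
      to Pjv with proj₁ (split j) Pjv
      ... | inj₁ (e′ , _) = ⊥-elim (1+n≢n (trans (sym e) e′))
      ... | inj₂ (_ , Qv)  = Qv
    off : ∀ j → toℕ j ≢ a → toℕ j ≢ suc a → count (λ v → P? (j ∷ v)) (allVecs N k) ≡ 0
    off j ne₀ ne₁ = count-none _ reject (allVecs N k)
      where
      reject : ∀ v → ¬ P (j ∷ v)
      reject v Pjv with proj₁ (split j) Pjv
      ... | inj₁ (e , _) = ne₀ e
      ... | inj₂ (e , _) = ne₁ e

-- Staircases

-- Consecutive values of an ODCT transformation stay equal or go up by one.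
Step : ℕ → ℕ → Set
Step a b = b ≡ a ⊎ b ≡ suc a

step? : ∀ a b → Dec (Step a b)
step? a b = (b ℕ.≟ a) ⊎-dec (b ℕ.≟ suc a)

step-≥ : ∀ {a b} → Step a b → a ≤ b
step-≥ {a} (inj₁ refl) = ≤-refl
step-≥ {a} (inj₂ refl) = n≤1+n a

step-≤ : ∀ {a b} → Step a b → b ≤ suc a
step-≤ {a} (inj₁ refl) = n≤1+n a
step-≤ {a} (inj₂ refl) = ≤-refl

unit-step : ∀ {a b} → a ≤ b → ∣ a - b ∣ ≤ 1 → Step a b
unit-step {zero}  {zero}        _         _          = inj₁ refl
unit-step {zero}  {suc zero}    _         _          = inj₂ refl
unit-step {zero}  {suc (suc b)} _         (s≤s ())
unit-step {suc a} {suc b}       (s≤s a≤b) gap        = Sum.map (cong suc) (cong suc) (unit-step a≤b gap)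

Staircase : ∀ {N k} → ℕ → Vec (Fin N) k → Set
Staircase a []      = ⊤
Staircase a (j ∷ v) = Step a (toℕ j) × Staircase (toℕ j) v

staircase? : ∀ {N k} a (v : Vec (Fin N) k) → Dec (Staircase a v)
staircase? a []      = yes tt
staircase? a (j ∷ v) = step? a (toℕ j) ×-dec staircase? (toℕ j) v

staircase-cons : ∀ {N k} a (j : Fin N) →
  (λ (v : Vec (Fin N) k) → Staircase a (j ∷ v))
    ≐ (λ v → (toℕ j ≡ a × Staircase a v) ⊎ (toℕ j ≡ suc a × Staircase (suc a) v))
staircase-cons a j = to , from
  where
  to : ∀ {v} → Staircase a (j ∷ v) → (toℕ j ≡ a × Staircase a v) ⊎ (toℕ j ≡ suc a × Staircase (suc a) v)
  to {v} (inj₁ e , st) = inj₁ (e , subst (λ b → Staircase b v) e st)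
  to {v} (inj₂ e , st) = inj₂ (e , subst (λ b → Staircase b v) e st)
  from : ∀ {v} → (toℕ j ≡ a × Staircase a v) ⊎ (toℕ j ≡ suc a × Staircase (suc a) v) → Staircase a (j ∷ v)
  from {v} (inj₁ (e , st)) = inj₁ e , subst (λ b → Staircase b v) (sym e) st
  from {v} (inj₂ (e , st)) = inj₂ e , subst (λ b → Staircase b v) (sym e) st

-- OrderPreserving and Contraction, for tables with values in any Fin N.
Monotone : ∀ {N k} → Vec (Fin N) k → Set
Monotone {k = k} v = (x y : Fin k) → toℕ x ≤ toℕ y → toℕ (lookup v x) ≤ toℕ (lookup v y)

NonExpanding : ∀ {N k} → Vec (Fin N) k → Set
NonExpanding {k = k} v = (x y : Fin k) → ∣ toℕ (lookup v x) - toℕ (lookup v y) ∣ ≤ ∣ toℕ x - toℕ y ∣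

staircase-sandwich : ∀ {N k} (j : Fin N) (v : Vec (Fin N) k) → Staircase (toℕ j) v →
  (x y : Fin (suc k)) → toℕ x ≤ toℕ y →
  toℕ (lookup (j ∷ v) x) ≤ toℕ (lookup (j ∷ v) y)
    × toℕ (lookup (j ∷ v) y) ≤ toℕ (lookup (j ∷ v) x) + (toℕ y ∸ toℕ x)
staircase-sandwich j v        _           zero    zero    _         = ≤-refl , m≤m+n (toℕ j) 0
staircase-sandwich j (j′ ∷ v) (step , st) zero  (suc y) _         =
  let (j′≤ey , ey≤j′+y) = staircase-sandwich j′ v st zero y z≤n
  in  ≤-trans (step-≥ step) j′≤ey ,
      ≤-trans ey≤j′+y (≤-trans (+-monoˡ-≤ (toℕ y) (step-≤ step)) (≤-reflexive (sym (+-suc (toℕ j) (toℕ y)))))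
staircase-sandwich j (j′ ∷ v) (_ , st) (suc x) (suc y) (s≤s x≤y) = staircase-sandwich j′ v st x y x≤y

gap-bound : ∀ {a b c d} → a ≤ b → b ≤ a + (d ∸ c) → c ≤ d → ∣ a - b ∣ ≤ ∣ c - d ∣
gap-bound {a} {b} a≤b b≤ c≤d =
  subst₂ _≤_ (sym (m≤n⇒∣m-n∣≡n∸m a≤b)) (sym (m≤n⇒∣m-n∣≡n∸m c≤d)) (m≤n+o⇒m∸n≤o b a b≤)

staircase⇒monotone : ∀ {N k} (j : Fin N) (v : Vec (Fin N) k) → Staircase (toℕ j) v → Monotone (j ∷ v)
staircase⇒monotone j v st x y x≤y = proj₁ (staircase-sandwich j v st x y x≤y)

staircase⇒nonExpanding : ∀ {N k} (j : Fin N) (v : Vec (Fin N) k) → Staircase (toℕ j) v → NonExpanding (j ∷ v)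
staircase⇒nonExpanding j v st x y with ≤-total (toℕ x) (toℕ y)
... | inj₁ x≤y = let (le , ge) = staircase-sandwich j v st x y x≤y in gap-bound le ge x≤y
... | inj₂ y≤x = let (le , ge) = staircase-sandwich j v st y x y≤x
                 in subst₂ _≤_ (∣-∣-comm (toℕ (lookup (j ∷ v) y)) (toℕ (lookup (j ∷ v) x))) (∣-∣-comm (toℕ y) (toℕ x))
                                (gap-bound le ge y≤x)

monotone-nonExpanding⇒staircase : ∀ {N k} (j : Fin N) (v : Vec (Fin N) k) →
  Monotone (j ∷ v) → NonExpanding (j ∷ v) → Staircase (toℕ j) v
monotone-nonExpanding⇒staircase j []       mono ne = tt
monotone-nonExpanding⇒staircase j (j′ ∷ v) mono ne =
  unit-step (mono zero (suc zero) z≤n) (ne zero (suc zero)) ,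
  monotone-nonExpanding⇒staircase j′ v (λ x y x≤y → mono (suc x) (suc y) (s≤s x≤y)) (λ x y → ne (suc x) (suc y))

odct⇒staircase : ∀ {k} (i : Fin (suc k)) (v : Vec (Fin (suc k)) k) →
  IsODCT (i ∷ v) → toℕ i ≡ 0 × Staircase 0 v
odct⇒staircase i v (op , od , ctr) =
  i≡0 , subst (λ b → Staircase b v) i≡0 (monotone-nonExpanding⇒staircase i v op ctr)
  where
  i≡0 : toℕ i ≡ 0
  i≡0 = n≤0⇒n≡0 (od zero)

staircase⇒odct : ∀ {k} (i : Fin (suc k)) (v : Vec (Fin (suc k)) k) →
  toℕ i ≡ 0 → Staircase 0 v → IsODCT (i ∷ v)
staircase⇒odct i v i≡0 st = staircase⇒monotone i v st′ , decreasing , staircase⇒nonExpanding i v st′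
  where
  st′ : Staircase (toℕ i) v
  st′ = subst (λ b → Staircase b v) (sym i≡0) st
  -- the sandwich from position 0 bounds the value at x by toℕ i + x = x
  decreasing : OrderDecreasing (i ∷ v)
  decreasing x = subst (λ b → toℕ (lookup (i ∷ v) x) ≤ b + toℕ x) i≡0
                       (proj₂ (staircase-sandwich i v st′ zero x z≤n))

fixedFrom : ∀ {N k} → ℕ → Vec (Fin N) k → Subset k
fixedFrom p []      = []
fixedFrom p (j ∷ v) = does (toℕ j ℕ.≟ p) ∷ fixedFrom (suc p) v

does-≟-toℕ : ∀ {N p} (i j : Fin N) → toℕ j ≡ p → does (i ≟ j) ≡ does (toℕ i ℕ.≟ p)
does-≟-toℕ {p = p} i j j≡p with i ≟ j
... | yes i≡j = sym (dec-true (toℕ i ℕ.≟ p) (trans (cong toℕ i≡j) j≡p))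
... | no  i≢j = sym (dec-false (toℕ i ℕ.≟ p) (λ i≡p → i≢j (toℕ-injective (trans i≡p (sym j≡p)))))

-- Fix is fixedFrom at offset 0; the offset bookkeeping is done for any p.
tabulate-fixedFrom : ∀ {N k} p (v : Vec (Fin N) k) (e : Fin k → Fin N) → (∀ x → toℕ (e x) ≡ p + toℕ x) →
  tabulate (λ x → does (lookup v x ≟ e x)) ≡ fixedFrom p v
tabulate-fixedFrom p []      e e≡ = refl
tabulate-fixedFrom p (j ∷ v) e e≡ =
  cong₂ _∷_ (does-≟-toℕ j (e zero) (trans (e≡ zero) (+-identityʳ p)))
            (tabulate-fixedFrom (suc p) v (e ∘ suc) (λ x → trans (e≡ (suc x)) (+-suc p (toℕ x))))

f≡∣fixedFrom∣ : ∀ {n} (α : Transformation n) → f α ≡ ∣ fixedFrom 0 α ∣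
f≡∣fixedFrom∣ α = cong ∣_∣ (tabulate-fixedFrom 0 α id (λ _ → refl))

∣fixedFrom∣-hit : ∀ {N k p} (j : Fin N) (v : Vec (Fin N) k) →
  toℕ j ≡ p → ∣ fixedFrom p (j ∷ v) ∣ ≡ suc ∣ fixedFrom (suc p) v ∣
∣fixedFrom∣-hit {p = p} j v j≡p rewrite dec-true (toℕ j ℕ.≟ p) j≡p = refl

∣fixedFrom∣-miss : ∀ {N k p} (j : Fin N) (v : Vec (Fin N) k) →
  toℕ j ≢ p → ∣ fixedFrom p (j ∷ v) ∣ ≡ ∣ fixedFrom (suc p) v ∣
∣fixedFrom∣-miss {p = p} j v j≢p rewrite dec-false (toℕ j ℕ.≟ p) j≢p = refl

below-diagonal : ∀ {N k a p} (v : Vec (Fin N) k) → Staircase a v → suc a < p → ∣ fixedFrom p v ∣ ≡ 0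
below-diagonal []      _           _     = refl
below-diagonal {p = p} (j ∷ v) (step , st) a+1<p =
  trans (∣fixedFrom∣-miss j v (<⇒≢ j<p)) (below-diagonal v st (s≤s j<p))
  where
  j<p : toℕ j < p
  j<p = ≤-<-trans (step-≤ step) a+1<p

-- v continues a staircase from a fixed point with value a (so v starts at
-- position a + 1) and contains m further fixed points.
OnDiagonal : ∀ {N k} → ℕ → ℕ → Vec (Fin N) k → Set
OnDiagonal a m v = Staircase a v × ∣ fixedFrom (suc a) v ∣ ≡ m

onDiagonal? : ∀ {N k} a m (v : Vec (Fin N) k) → Dec (OnDiagonal a m v)
onDiagonal? a m v = staircase? a v ×-dec (∣ fixedFrom (suc a) v ∣ ℕ.≟ m)

onDiagonal-leave : ∀ {N k} a (j : Fin N) →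
  (λ (v : Vec (Fin N) k) → OnDiagonal a 0 (j ∷ v)) ≐ (λ v → toℕ j ≡ a × Staircase a v)
onDiagonal-leave a j = to , from
  where
  to : ∀ {v} → OnDiagonal a 0 (j ∷ v) → toℕ j ≡ a × Staircase a v
  to {v} ((inj₁ e , st) , _)    = e , subst (λ b → Staircase b v) e st
  to {v} ((inj₂ e , _)  , none) = ⊥-elim (1+n≢0 (trans (sym (∣fixedFrom∣-hit j v e)) none))
  from : ∀ {v} → toℕ j ≡ a × Staircase a v → OnDiagonal a 0 (j ∷ v)
  from {v} (e , st) =
    (inj₁ e , subst (λ b → Staircase b v) (sym e) st) ,
    trans (∣fixedFrom∣-miss j v (λ e′ → 1+n≢n (trans (sym e′) e))) (below-diagonal v st ≤-refl)

onDiagonal-stay : ∀ {N k} a m (j : Fin N) →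
  (λ (v : Vec (Fin N) k) → OnDiagonal a (suc m) (j ∷ v)) ≐ (λ v → toℕ j ≡ suc a × OnDiagonal (suc a) m v)
onDiagonal-stay a m j = to , from
  where
  to : ∀ {v} → OnDiagonal a (suc m) (j ∷ v) → toℕ j ≡ suc a × OnDiagonal (suc a) m v
  to {v} ((inj₂ e , st) , fx) =
    e , subst (λ b → Staircase b v) e st , suc-injective (trans (sym (∣fixedFrom∣-hit j v e)) fx)
  to {v} ((inj₁ e , st) , fx) = ⊥-elim (0≢1+n (trans (sym none) (trans (sym miss) fx)))
    where
    miss : ∣ fixedFrom (suc a) (j ∷ v) ∣ ≡ ∣ fixedFrom (suc (suc a)) v ∣
    miss = ∣fixedFrom∣-miss j v (λ e′ → 1+n≢n (trans (sym e′) e))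
    none : ∣ fixedFrom (suc (suc a)) v ∣ ≡ 0
    none = below-diagonal v (subst (λ b → Staircase b v) e st) ≤-refl
  from : ∀ {v} → toℕ j ≡ suc a × OnDiagonal (suc a) m v → OnDiagonal a (suc m) (j ∷ v)
  from {v} (e , st , fx) =
    (inj₂ e , subst (λ b → Staircase b v) (sym e) st) , trans (∣fixedFrom∣-hit j v e) (cong suc fx)

-- A staircase of length k+1 after a fits below N: so do its first entry and its tail,
-- whether the first step is flat (a, then k steps) or up (a+1, then k steps).
room-here : ∀ {N k a} → a + suc k < N → a < N
room-here {k = k} {a} h = ≤-<-trans (m≤m+n a (suc k)) h

room-tail : ∀ {N k a} → a + suc k < N → a + k < N
room-tail {k = k} {a} h = ≤-<-trans (+-monoʳ-≤ a (n≤1+n k)) h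

room-next : ∀ {N k a} → a + suc k < N → suc a + k < N
room-next {N} {k} {a} h = subst (_< N) (+-suc a k) h

room-head : ∀ {N k a} → a + suc k < N → suc a < N
room-head {k = k} {a} h = ≤-<-trans (m≤m+n (suc a) k) (room-next h)

count-staircases : ∀ {N k a} → a + k < N → count (staircase? a) (allVecs N k) ≡ 2 ^ k
count-staircases {k = zero} _ = refl
count-staircases {N} {suc k} {a} h = begin
  count (staircase? a) (allVecs N (suc k))
    ≡⟨ count-head-pair (staircase? a) (staircase? a) (staircase? (suc a)) (room-head h) (staircase-cons a) ⟩
  count (staircase? a) (allVecs N k) + count (staircase? (suc a)) (allVecs N k)
    ≡⟨ cong₂ _+_ (count-staircases {k = k} {a} (room-tail h))
                (count-staircases {k = k} {suc a} (room-next h)) ⟩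
  2 ^ k + 2 ^ k
    ≡⟨ cong (2 ^ k +_) (sym (+-identityʳ (2 ^ k))) ⟩
  2 ^ suc k
    ∎
  where open ≡-Reasoning

count-diagonal-full : ∀ {N k a} → a + k < N → count (onDiagonal? a k) (allVecs N k) ≡ 1
count-diagonal-full {k = zero} _ = refl
count-diagonal-full {N} {suc k} {a} h =
  trans (count-head-point (onDiagonal? a (suc k)) (onDiagonal? (suc a) k) (room-head h) (onDiagonal-stay a k))
        (count-diagonal-full {k = k} {suc a} (room-next h))

-- With m < k fixed points: m steps up, one flat step, then any staircase.
count-diagonal-partial : ∀ {N k a m} → a + k < N → m < k → count (onDiagonal? a m) (allVecs N k) ≡ 2 ^ (k ∸ m ∸ 1)
count-diagonal-partial {N} {suc k} {a} {zero} h _ =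
  trans (count-head-point (onDiagonal? a 0) (staircase? a) (room-here h) (onDiagonal-leave a))
        (count-staircases {k = k} {a} (room-tail h))
count-diagonal-partial {N} {suc k} {a} {suc m} h (s≤s m<k) =
  trans (count-head-point (onDiagonal? a (suc m)) (onDiagonal? (suc a) m) (room-head h) (onDiagonal-stay a m))
        (count-diagonal-partial {k = k} {suc a} (room-next h) m<k)

odct-with-fixed-points : ∀ {k} m (i : Fin (suc k)) →
  (λ (v : Vec (Fin (suc k)) k) → IsODCT (i ∷ v) × f (i ∷ v) ≡ suc m) ≐ (λ v → toℕ i ≡ 0 × OnDiagonal 0 m v)
odct-with-fixed-points m i = to , from
  where
  f-cons : ∀ {v} → toℕ i ≡ 0 → f (i ∷ v) ≡ suc ∣ fixedFrom 1 v ∣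
  f-cons {v} i≡0 = trans (f≡∣fixedFrom∣ (i ∷ v)) (∣fixedFrom∣-hit i v i≡0)
  to : ∀ {v} → IsODCT (i ∷ v) × f (i ∷ v) ≡ suc m → toℕ i ≡ 0 × OnDiagonal 0 m v
  to {v} (odct , fα) = let (i≡0 , st) = odct⇒staircase i v odct
                       in i≡0 , st , suc-injective (trans (sym (f-cons {v} i≡0)) fα)
  from : ∀ {v} → toℕ i ≡ 0 × OnDiagonal 0 m v → IsODCT (i ∷ v) × f (i ∷ v) ≡ suc m
  from {v} (i≡0 , st , fx) = staircase⇒odct i v i≡0 st , trans (f-cons {v} i≡0) (cong suc fx)

countODCT-diagonal : ∀ k m → countODCT (suc k) (suc m) ≡ count (onDiagonal? 0 m) (allVecs (suc k) k)
countODCT-diagonal k m =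
  count-head-point {k = k} (λ α → isODCT? α ×-dec (f α ℕ.≟ suc m)) (onDiagonal? 0 m) (s≤s z≤n) (odct-with-fixed-points m)

corollary4p5 : ((n : ℕ) → 1 ≤ n → countODCT n n ≡ 1)
    × ((n m : ℕ) → 1 ≤ m → m < n → countODCT n m ≡ 2 ^ (n ∸ m ∸ 1))
corollary4p5 = all-fixed , some-fixed
  where
  all-fixed : (n : ℕ) → 1 ≤ n → countODCT n n ≡ 1
  all-fixed (suc k) _ = trans (countODCT-diagonal k k) (count-diagonal-full {k = k} {0} ≤-refl)
  some-fixed : (n m : ℕ) → 1 ≤ m → m < n → countODCT n m ≡ 2 ^ (n ∸ m ∸ 1)
  some-fixed (suc k) (suc m) _ (s≤s m<k) = trans (countODCT-diagonal k m) (count-diagonal-partial {k = k} {0} ≤-refl m<k)
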